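{- For every even positive integer $n$, letting $\frac{n}{2}\cdot K_2$ denote the graph consisting of $n/2$ pairwise disjoint edges (a perfect matching on $n$ vertices), \[ \chi_{2K_2}\!\left(\frac{n}{2}\cdot K_2\right) = \left\lceil \sqrt{n + \frac14} + \frac12 \right\rceil . \]
   Context: All graphs are finite and simple. $2K_2$ denotes the graph consisting of two disjoint edges. For a fixed bipartite graph $H$, a proper vertex coloring of a graph $G$ is called an $H$-avoiding coloring if for any two color classes, the subgraph of $G$ induced by their union contains no induced subgraph isomorphic to $H$. $\chi_H(G)$ denotes the minimum number of colors in an $H$-avoiding coloring of $G$. -}

module Defs where

open import Data.Nat using (ℕ; _+_; _*_; _∸_; _≤_; _<_; _/_)
open import Data.Fin using (Fin; toℕ)
open import Data.Product using (_×_; Σ)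
open import Data.Sum using (_⊎_)
open import Relation.Nullary using (¬_)
open import Relation.Binary.PropositionalEquality using (_≡_; _≢_)

record Graph : Set₁ where
  field
    n     : ℕ
    Adj   : Fin n → Fin n → Set
    irrefl : ∀ {u} → ¬ Adj u u
    sym    : ∀ {u v} → Adj u v → Adj v u
open Graph public

-- (n/2)·K₂ as a graph on n vertices: vertices 2i and 2i+1 are adjacent.
matchingAdj : (n : ℕ) → Fin n → Fin n → Set
matchingAdj n u v = (toℕ u / 2 ≡ toℕ v / 2) × (u ≢ v)

matching : ℕ → Graph
matching n = record
  { n = n
  ; Adj = matchingAdj n
  ; irrefl = λ { (_ , u≢u) → u≢u Relation.Binary.PropositionalEquality.refl }
  ; sym = λ { (e , ne) → Relation.Binary.PropositionalEquality.sym e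
                         , (λ q → ne (Relation.Binary.PropositionalEquality.sym q)) }
  }
  where open Data.Product using (_,_)

Coloring : Graph → ℕ → Set
Coloring G k = Fin (n G) → Fin k

Proper : (G : Graph) {k : ℕ} → Coloring G k → Set
Proper G c = ∀ u v → Adj G u v → c u ≢ c v

Induced2K2 : (G : Graph) → (u₁ v₁ u₂ v₂ : Fin (n G)) → Set
Induced2K2 G u₁ v₁ u₂ v₂ =
  (u₁ ≢ v₁) × (u₁ ≢ u₂) × (u₁ ≢ v₂) × (v₁ ≢ u₂) × (v₁ ≢ v₂) × (u₂ ≢ v₂) ×
  Adj G u₁ v₁ × Adj G u₂ v₂ ×
  ¬ Adj G u₁ u₂ × ¬ Adj G u₁ v₂ × ¬ Adj G v₁ u₂ × ¬ Adj G v₁ v₂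

InClasses : {k : ℕ} → Fin k → Fin k → Fin k → Set
InClasses a b x = (x ≡ a) ⊎ (x ≡ b)

Avoiding2K2 : (G : Graph) {k : ℕ} → Coloring G k → Set
Avoiding2K2 G {k} c =
  Proper G c ×
  (∀ (a b : Fin k) (u₁ v₁ u₂ v₂ : Fin (n G)) →
     InClasses a b (c u₁) → InClasses a b (c v₁) →
     InClasses a b (c u₂) → InClasses a b (c v₂) →
     ¬ Induced2K2 G u₁ v₁ u₂ v₂)

Avoiding2K2Colorable : Graph → ℕ → Set
Avoiding2K2Colorable G k = Σ (Coloring G k) (Avoiding2K2 G)

Chi2K2 : Graph → ℕ → Set
Chi2K2 G k = Avoiding2K2Colorable G k × (∀ j → j < k → ¬ Avoiding2K2Colorable G j)

-- k = ⌈ √(n + 1/4) + 1/2 ⌉, characterized by (k-1) < √(n+1/4)+1/2 ≤ k,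
-- which for natural n ≥ 1 is equivalent to  (k-1)(k-2) < n ≤ k(k-1).
IsCeilSqrtExpr : ℕ → ℕ → Set
IsCeilSqrtExpr n k = (n ≤ k * (k ∸ 1)) × ((k ∸ 1) * (k ∸ 2) < n)

-- In a 2K₂-avoiding colouring, at most one edge of the matching has both ends in a given pair of
-- colour classes {a, b}: two such edges would induce a 2K₂ inside a ∪ b. Hence v ↦ (c v , c (mate v))
-- is injective into ordered pairs of distinct colours, so 2m ≤ j (j − 1). Conversely, giving the
-- m edges distinct 2-subsets of the k colours is 2K₂-avoiding, which is possible when m ≤ k (k − 1) / 2.
module Submission where

open import Defs hiding (sym)
open import Data.Nat using (ℕ; zero; suc; _+_; _*_; _∸_; _≤_; _<_; _/_; s≤s; NonZero)
open import Data.Nat.Properties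
  using (*-comm; *-distribˡ-+; +-identityʳ; *-cancelˡ-≤; *-mono-≤; ∸-monoˡ-≤; <⇒≱; ≤-trans)
open import Data.Nat.Divisibility using (m∣m*n)
open import Data.Nat.DivMod using (+-distrib-/-∣ˡ; m*n/n≡m; m<n⇒m/n≡0)
open import Data.Nat.Tactic.RingSolver using (solve-∀)
open import Data.Fin
  using (Fin; toℕ; fromℕ; inject₁; inject≤; splitAt; cast; combine; remQuot; punchOut; opposite; _↑ˡ_; _↑ʳ_)
  renaming (_<_ to _<ᶠ_)
open import Data.Fin.Patterns using (0F; 1F)
open import Data.Fin.Properties
  using (¬Fin0; toℕ<n; toℕ-injective; toℕ-inject₁; toℕ-fromℕ; inject≤-injective; toℕ-cast; toℕ-combine; toℕ-↑ˡ; toℕ-↑ʳ;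
         splitAt⁻¹-↑ˡ; splitAt⁻¹-↑ʳ; cast-involutive; combine-remQuot; remQuot-combine; combine-injective;
         punchOut-injective; injective⇒≤; <-irrefl; <-asym; _≟_)
open import Data.Product using (_×_; _,_; proj₁; proj₂; map; uncurry)
open import Data.Product.Properties using (×-≡,≡→≡)
open import Data.Sum using (_⊎_; inj₁; inj₂; [_,_]′)
open import Function using (_∘_)
open import Function.Definitions using (Injective)
open import Relation.Nullary using (¬_; yes; no; contradiction)
open import Relation.Binary.PropositionalEquality
  using (_≡_; _≢_; refl; sym; trans; cong; cong₂; subst; subst₂; module ≡-Reasoning)

s≢t⇒r≡s⊎r≡t : {r s t : Fin 2} → s ≢ t → r ≡ s ⊎ r ≡ t
s≢t⇒r≡s⊎r≡t {_}  {0F} {0F} s≢t = contradiction refl s≢t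
s≢t⇒r≡s⊎r≡t {_}  {1F} {1F} s≢t = contradiction refl s≢t
s≢t⇒r≡s⊎r≡t {0F} {0F} {1F} _   = inj₁ refl
s≢t⇒r≡s⊎r≡t {1F} {0F} {1F} _   = inj₂ refl
s≢t⇒r≡s⊎r≡t {0F} {1F} {0F} _   = inj₂ refl
s≢t⇒r≡s⊎r≡t {1F} {1F} {0F} _   = inj₁ refl

opposite-≢ : (s : Fin 2) → opposite s ≢ s
opposite-≢ 0F ()
opposite-≢ 1F ()

component : {A : Set} → Fin 2 → A × A → A
component 0F = proj₁
component 1F = proj₂

Increasing : {k : ℕ} → Fin k × Fin k → Set
Increasing (x , y) = x <ᶠ y

component-injective : ∀ {k} {p : Fin k × Fin k} → Increasing p →
                      ∀ {s t} → component s p ≡ component t p → s ≡ t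
component-injective x<y {0F} {0F} _ = refl
component-injective x<y {1F} {1F} _ = refl
component-injective x<y {0F} {1F} x≡y = contradiction x<y (<-irrefl x≡y)
component-injective x<y {1F} {0F} y≡x = contradiction x<y (<-irrefl (sym y≡x))

increasing⊆classes-unique : ∀ {k} {a b : Fin k} {p q : Fin k × Fin k} → Increasing p → Increasing q →
                    (∀ s → InClasses a b (component s p)) → (∀ s → InClasses a b (component s q)) → p ≡ q
increasing⊆classes-unique {p = x , y} {x′ , y′} x<y x′<y′ p⊆ q⊆ = go (p⊆ 0F) (p⊆ 1F) (q⊆ 0F) (q⊆ 1F)
  where
  go : InClasses _ _ x → InClasses _ _ y → InClasses _ _ x′ → InClasses _ _ y′ → (x , y) ≡ (x′ , y′)
  go (inj₁ refl) (inj₁ refl) _ _ = contradiction x<y (<-irrefl refl)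
  go (inj₂ refl) (inj₂ refl) _ _ = contradiction x<y (<-irrefl refl)
  go _ _ (inj₁ refl) (inj₁ refl) = contradiction x′<y′ (<-irrefl refl)
  go _ _ (inj₂ refl) (inj₂ refl) = contradiction x′<y′ (<-irrefl refl)
  go (inj₁ refl) (inj₂ refl) (inj₁ refl) (inj₂ refl) = refl
  go (inj₂ refl) (inj₁ refl) (inj₂ refl) (inj₁ refl) = refl
  go (inj₁ refl) (inj₂ refl) (inj₂ refl) (inj₁ refl) = contradiction x′<y′ (<-asym x<y)
  go (inj₂ refl) (inj₁ refl) (inj₁ refl) (inj₂ refl) = contradiction x′<y′ (<-asym x<y)

choose₂ : ℕ → ℕ
choose₂ zero    = zero
choose₂ (suc k) = choose₂ k + k

2*choose₂≡k*[k∸1] : ∀ k → 2 * choose₂ k ≡ k * (k ∸ 1)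
2*choose₂≡k*[k∸1] zero          = refl
2*choose₂≡k*[k∸1] (suc zero)    = refl
2*choose₂≡k*[k∸1] (suc (suc k)) = begin
  2 * (choose₂ (suc k) + suc k)     ≡⟨ *-distribˡ-+ 2 (choose₂ (suc k)) (suc k) ⟩
  2 * choose₂ (suc k) + 2 * suc k   ≡⟨ cong (_+ 2 * suc k) (2*choose₂≡k*[k∸1] (suc k)) ⟩
  suc k * k + 2 * suc k             ≡⟨ step k ⟩
  suc (suc k) * suc k               ∎
  where
  open ≡-Reasoning
  step : ∀ k → suc k * k + 2 * suc k ≡ suc (suc k) * suc k
  step = solve-∀

-- Fin (choose₂ (suc k)) = Fin (choose₂ k + k): the first block enumerates the pairs below k,
-- the second the pairs (a , k) with a < k.
increasingPair : ∀ k → Fin (choose₂ k) → Fin k × Fin k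
increasingPair (suc k) i = [ map inject₁ inject₁ ∘ increasingPair k , (λ a → inject₁ a , fromℕ k) ]′
                             (splitAt (choose₂ k) i)

rank : ∀ {k} → Fin k × Fin k → ℕ
rank (x , y) = choose₂ (toℕ y) + toℕ x

rank-inject₁ : ∀ {k} (p : Fin k × Fin k) → rank (map inject₁ inject₁ p) ≡ rank p
rank-inject₁ (x , y) = cong₂ (λ b a → choose₂ b + a) (toℕ-inject₁ y) (toℕ-inject₁ x)

rank-increasingPair : ∀ k i → rank (increasingPair k i) ≡ toℕ i
rank-increasingPair (suc k) i with splitAt (choose₂ k) i in eq
... | inj₁ j = begin
  rank (map inject₁ inject₁ (increasingPair k j)) ≡⟨ rank-inject₁ (increasingPair k j) ⟩
  rank (increasingPair k j)                       ≡⟨ rank-increasingPair k j ⟩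
  toℕ j                                           ≡⟨ toℕ-↑ˡ j k ⟨
  toℕ (j ↑ˡ k)                                    ≡⟨ cong toℕ (splitAt⁻¹-↑ˡ eq) ⟩
  toℕ i                                           ∎
  where open ≡-Reasoning
... | inj₂ a = begin
  choose₂ (toℕ (fromℕ k)) + toℕ (inject₁ a) ≡⟨ cong₂ (λ b c → choose₂ b + c) (toℕ-fromℕ k) (toℕ-inject₁ a) ⟩
  choose₂ k + toℕ a                         ≡⟨ toℕ-↑ʳ (choose₂ k) a ⟨
  toℕ (choose₂ k ↑ʳ a)                      ≡⟨ cong toℕ (splitAt⁻¹-↑ʳ eq) ⟩
  toℕ i                                     ∎
  where open ≡-Reasoning

increasingPair-injective : ∀ k → Injective _≡_ _≡_ (increasingPair k)
increasingPair-injective k {i} {j} eq = toℕ-injective (begin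
  toℕ i                     ≡⟨ rank-increasingPair k i ⟨
  rank (increasingPair k i) ≡⟨ cong rank eq ⟩
  rank (increasingPair k j) ≡⟨ rank-increasingPair k j ⟩
  toℕ j                     ∎)
  where open ≡-Reasoning

increasingPair-increasing : ∀ k i → Increasing (increasingPair k i)
increasingPair-increasing (suc k) i with splitAt (choose₂ k) i
... | inj₁ j with increasingPair k j | increasingPair-increasing k j
...   | x , y | x<y = subst₂ _<_ (sym (toℕ-inject₁ x)) (sym (toℕ-inject₁ y)) x<y
increasingPair-increasing (suc k) i | inj₂ a =
  subst₂ _<_ (sym (toℕ-inject₁ a)) (sym (toℕ-fromℕ k)) (toℕ<n a)

punchOut-cong-injective : ∀ {n} {i i′ j j′ : Fin (suc n)} (i≢j : i ≢ j) (i′≢j′ : i′ ≢ j′) →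
                          i ≡ i′ → punchOut i≢j ≡ punchOut i′≢j′ → j ≡ j′
punchOut-cong-injective i≢j i′≢j′ refl = punchOut-injective i≢j i′≢j′

offDiagonal-injective⇒≤ : ∀ {n j} (f : Fin n → Fin j × Fin j) → Injective _≡_ _≡_ f →
                          (∀ x → proj₁ (f x) ≢ proj₂ (f x)) → n ≤ j * (j ∸ 1)
offDiagonal-injective⇒≤ {j = zero}  f _ _ = injective⇒≤ {f = proj₁ ∘ f} (λ {x} _ → contradiction (proj₁ (f x)) ¬Fin0)
offDiagonal-injective⇒≤ {n} {suc j} f f-injective distinct = injective⇒≤ g-injective
  where
  g : Fin n → Fin (suc j * j)
  g x = combine (proj₁ (f x)) (punchOut (distinct x))
  g-injective : Injective _≡_ _≡_ g
  g-injective {x} {y} eq with combine-injective _ _ _ _ eq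
  ... | a≡a′ , p≡p′ = f-injective (×-≡,≡→≡ (a≡a′ , punchOut-cong-injective (distinct x) (distinct y) a≡a′ p≡p′))

record MatchingStructure (G : Graph) (m : ℕ) : Set where
  field
    edge           : Fin (n G) → Fin m
    side           : Fin (n G) → Fin 2
    adj⇒edge≡      : ∀ {u v} → Adj G u v → edge u ≡ edge v
    edge≡⇒adj      : ∀ {u v} → edge u ≡ edge v → u ≢ v → Adj G u v
    side-injective : ∀ {u v} → edge u ≡ edge v → side u ≡ side v → u ≡ v
    mate           : Fin (n G) → Fin (n G)
    adj-mate       : ∀ v → Adj G v (mate v)

module _ {G : Graph} {m : ℕ} (M : MatchingStructure G m) where
  open MatchingStructure M

  adj⇒≢ : ∀ {u v} → Adj G u v → u ≢ v
  adj⇒≢ {u} a refl = irrefl G a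

  adj⇒side≢ : ∀ {u v} → Adj G u v → side u ≢ side v
  adj⇒side≢ a = adj⇒≢ a ∘ side-injective (adj⇒edge≡ a)

  induced2K2⇒edge≢ : ∀ {u₁ v₁ u₂ v₂} → Induced2K2 G u₁ v₁ u₂ v₂ → edge u₁ ≢ edge u₂
  induced2K2⇒edge≢ (_ , u₁≢u₂ , _ , _ , _ , _ , _ , _ , ¬u₁u₂ , _) e = ¬u₁u₂ (edge≡⇒adj e u₁≢u₂)

  edge≢⇒induced2K2 : ∀ {u₁ v₁ u₂ v₂} → Adj G u₁ v₁ → Adj G u₂ v₂ → edge u₁ ≢ edge u₂ →
                     Induced2K2 G u₁ v₁ u₂ v₂
  edge≢⇒induced2K2 {u₁} {v₁} {u₂} {v₂} a₁ a₂ e₁≢e₂ =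
    adj⇒≢ a₁ , ≢ refl refl , ≢ refl e₂ , ≢ e₁ refl , ≢ e₁ e₂ , adj⇒≢ a₂ , a₁ , a₂ ,
    ¬adj refl refl , ¬adj refl e₂ , ¬adj e₁ refl , ¬adj e₁ e₂
    where
    e₁ = sym (adj⇒edge≡ a₁)
    e₂ = sym (adj⇒edge≡ a₂)
    apart : ∀ {x y} → edge x ≡ edge u₁ → edge y ≡ edge u₂ → edge x ≢ edge y
    apart x₁ y₂ xy = e₁≢e₂ (trans (sym x₁) (trans xy y₂))
    ≢ : ∀ {x y} → edge x ≡ edge u₁ → edge y ≡ edge u₂ → x ≢ y
    ≢ x₁ y₂ refl = apart x₁ y₂ refl
    ¬adj : ∀ {x y} → edge x ≡ edge u₁ → edge y ≡ edge u₂ → ¬ Adj G x y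
    ¬adj x₁ y₂ = apart x₁ y₂ ∘ adj⇒edge≡

  lowerBound : ∀ {j} → Avoiding2K2Colorable G j → n G ≤ j * (j ∸ 1)
  lowerBound (c , proper , avoids) =
    offDiagonal-injective⇒≤ colourPair colourPair-injective (λ v → proper v (mate v) (adj-mate v))
    where
    colourPair : Fin (n G) → Fin _ × Fin _
    colourPair v = c v , c (mate v)
    colourPair-injective : Injective _≡_ _≡_ colourPair
    colourPair-injective {v} {w} eq with v ≟ w | edge v ≟ edge w
    ... | yes v≡w | _      = v≡w
    ... | no v≢w  | yes e  = contradiction (cong proj₁ eq) (proper v w (edge≡⇒adj e v≢w))
    ... | no _    | no e≢ = contradiction (edge≢⇒induced2K2 (adj-mate v) (adj-mate w) e≢)
      (avoids (c v) (c (mate v)) v (mate v) w (mate w)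
              (inj₁ refl) (inj₂ refl) (inj₁ (sym (cong proj₁ eq))) (inj₂ (sym (cong proj₂ eq))))

  module _ {k} (pair : Fin m → Fin k × Fin k) (pair-injective : Injective _≡_ _≡_ pair)
           (pair-increasing : ∀ i → Increasing (pair i)) where

    colouring : Coloring G k
    colouring v = component (side v) (pair (edge v))

    colouring-proper : Proper G colouring
    colouring-proper u v a eq = adj⇒side≢ a (component-injective (pair-increasing (edge u))
      (trans eq (cong (λ i → component (side v) (pair i)) (sym (adj⇒edge≡ a)))))

    adj⇒pair⊆classes : ∀ {a b u v} → Adj G u v → InClasses a b (colouring u) → InClasses a b (colouring v) →
                       ∀ s → InClasses a b (component s (pair (edge u)))
    adj⇒pair⊆classes {a} {b} {u} {v} uv u∈ v∈ s with s≢t⇒r≡s⊎r≡t {s} (adj⇒side≢ uv)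
    ... | inj₁ refl = u∈
    ... | inj₂ refl = subst (InClasses a b) (cong (λ i → component (side v) (pair i)) (sym (adj⇒edge≡ uv))) v∈

    colouring-avoiding : Avoiding2K2 G colouring
    colouring-avoiding = colouring-proper , λ a b u₁ v₁ u₂ v₂ u₁∈ v₁∈ u₂∈ v₂∈ induced →
      let (_ , _ , _ , _ , _ , _ , u₁v₁ , u₂v₂ , _) = induced
      in induced2K2⇒edge≢ induced (pair-injective (increasing⊆classes-unique (pair-increasing _) (pair-increasing _)
           (adj⇒pair⊆classes u₁v₁ u₁∈ v₁∈) (adj⇒pair⊆classes u₂v₂ u₂∈ v₂∈)))

  upperBound : ∀ {k} → 2 * m ≤ k * (k ∸ 1) → Avoiding2K2Colorable G k
  upperBound {k} 2m≤k[k∸1] = colouring pair pair-injective pair-increasing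
                           , colouring-avoiding pair pair-injective pair-increasing
    where
    m≤choose₂ : m ≤ choose₂ k
    m≤choose₂ = *-cancelˡ-≤ 2 (subst (2 * m ≤_) (sym (2*choose₂≡k*[k∸1] k)) 2m≤k[k∸1])
    pair : Fin m → Fin k × Fin k
    pair i = increasingPair k (inject≤ i m≤choose₂)
    pair-injective : Injective _≡_ _≡_ pair
    pair-injective = inject≤-injective m≤choose₂ m≤choose₂ _ _ ∘ increasingPair-injective k
    pair-increasing : ∀ i → Increasing (pair i)
    pair-increasing i = increasingPair-increasing k (inject≤ i m≤choose₂)

[n*i+j]/n≡i : ∀ n {i j} .{{_ : NonZero n}} → j < n → (n * i + j) / n ≡ i
[n*i+j]/n≡i n {i} {j} j<n = begin
  (n * i + j) / n     ≡⟨ +-distrib-/-∣ˡ j (m∣m*n i) ⟩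
  n * i / n + j / n   ≡⟨ cong₂ _+_ (trans (cong (_/ n) (*-comm n i)) (m*n/n≡m i n)) (m<n⇒m/n≡0 j<n) ⟩
  i + 0               ≡⟨ +-identityʳ i ⟩
  i                   ∎
  where open ≡-Reasoning

module MatchingGraph (m : ℕ) where

  vertex : Fin m → Fin 2 → Fin (2 * m)
  vertex i s = cast (*-comm m 2) (combine i s)

  split : Fin (2 * m) → Fin m × Fin 2
  split v = remQuot 2 (cast (*-comm 2 m) v)

  edge : Fin (2 * m) → Fin m
  edge = proj₁ ∘ split

  side : Fin (2 * m) → Fin 2
  side = proj₂ ∘ split

  mate : Fin (2 * m) → Fin (2 * m)
  mate v = vertex (edge v) (opposite (side v))

  vertex-split : ∀ v → uncurry vertex (split v) ≡ v
  vertex-split v = trans (cong (cast (*-comm m 2)) (combine-remQuot {m} 2 (cast (*-comm 2 m) v)))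
                         (cast-involutive (*-comm m 2) (*-comm 2 m) v)

  split-vertex : ∀ i s → split (vertex i s) ≡ (i , s)
  split-vertex i s = trans (cong (remQuot 2) (cast-involutive (*-comm 2 m) (*-comm m 2) (combine i s)))
                           (remQuot-combine i s)

  toℕ-vertex/2 : ∀ i s → toℕ (vertex i s) / 2 ≡ toℕ i
  toℕ-vertex/2 i s = trans (cong (_/ 2) (trans (toℕ-cast (*-comm m 2) (combine i s)) (toℕ-combine i s)))
                           ([n*i+j]/n≡i 2 (toℕ<n s))

  toℕ-edge : ∀ v → toℕ (edge v) ≡ toℕ v / 2
  toℕ-edge v = trans (sym (toℕ-vertex/2 (edge v) (side v))) (cong (λ w → toℕ w / 2) (vertex-split v))

  adj⇒edge≡ : ∀ {u v} → matchingAdj (2 * m) u v → edge u ≡ edge v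
  adj⇒edge≡ {u} {v} (u/2≡v/2 , _) = toℕ-injective (trans (toℕ-edge u) (trans u/2≡v/2 (sym (toℕ-edge v))))

  edge≡⇒adj : ∀ {u v} → edge u ≡ edge v → u ≢ v → matchingAdj (2 * m) u v
  edge≡⇒adj {u} {v} e u≢v = trans (sym (toℕ-edge u)) (trans (cong toℕ e) (toℕ-edge v)) , u≢v

  side-injective : ∀ {u v} → edge u ≡ edge v → side u ≡ side v → u ≡ v
  side-injective {u} {v} e s = trans (sym (vertex-split u)) (trans (cong₂ vertex e s) (vertex-split v))

  adj-mate : ∀ v → matchingAdj (2 * m) v (mate v)
  adj-mate v = edge≡⇒adj (sym (cong proj₁ split-mate))
                         (λ v≡mate → opposite-≢ (side v) (trans (sym (cong proj₂ split-mate)) (cong side (sym v≡mate))))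
    where
    split-mate : split (mate v) ≡ (edge v , opposite (side v))
    split-mate = split-vertex (edge v) (opposite (side v))

  structure : MatchingStructure (matching (2 * m)) m
  structure = record
    { edge = edge ; side = side ; adj⇒edge≡ = adj⇒edge≡ ; edge≡⇒adj = edge≡⇒adj
    ; side-injective = side-injective ; mate = mate ; adj-mate = adj-mate }

m<n⇒m*[m∸1]≤[n∸1]*[n∸2] : ∀ {j k} → j < k → j * (j ∸ 1) ≤ (k ∸ 1) * (k ∸ 2)
m<n⇒m*[m∸1]≤[n∸1]*[n∸2] (s≤s j≤k∸1) = *-mono-≤ j≤k∸1 (∸-monoˡ-≤ 1 j≤k∸1)

-- The hypothesis 1 ≤ m is implied by (k ∸ 1) * (k ∸ 2) < 2 * m.
corollary5p3 : ∀ (m : ℕ) → 1 ≤ m → ∀ (k : ℕ) → IsCeilSqrtExpr (2 * m) k →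
    Chi2K2 (matching (2 * m)) k
corollary5p3 m _ k (2m≤k[k∸1] , [k∸1][k∸2]<2m) = upperBound M 2m≤k[k∸1] , fewerColoursFail
  where
  M : MatchingStructure (matching (2 * m)) m
  M = MatchingGraph.structure m
  fewerColoursFail : ∀ j → j < k → ¬ Avoiding2K2Colorable (matching (2 * m)) j
  fewerColoursFail j j<k colouring =
    <⇒≱ [k∸1][k∸2]<2m (≤-trans (lowerBound M colouring) (m<n⇒m*[m∸1]≤[n∸1]*[n∸2] j<k))
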